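{- Let $\mathbb{K}$ be an infinite field and $M$ a monomial ideal of $\mathbb{K}[x_1,\dots,x_n]$. Then its unique minimal monomial generating set is a minimal Newton basis of $M$.
   Context: $\mathcal{A}$: lattice polytopes with vertices in $\mathbb{Z}^n_{\ge0}$ plus $0_{\mathcal{A}}$; $\oplus$ = convex hull of union, $\odot$ = Minkowski sum. ${\rm New}$ maps a nonzero polynomial to its Newton polytope and $0$ to $0_{\mathcal{A}}$. A Newton basis of an ideal $I$ is a subset $S\subseteq I$ such that $\{{\rm New}(p)\}_{p\in S}$ generates ${\rm New}(I)=\{{\rm New}(p):p\in I\}$ as a sub-semimodule of $\mathcal{A}$; it is minimal if no proper subset of $S$ is a Newton basis of $I$. -}

module Defs where

open import Level using (Level; _⊔_; suc)
open import Algebra.Bundles using (CommutativeRing)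
open import Data.Nat as ℕ using (ℕ)
open import Data.Fin using (Fin)
open import Data.Vec as V using (Vec)
open import Data.Vec.Properties using (≡-dec)
open import Data.List as L using (List; []; _∷_; _++_)
open import Data.List.Relation.Unary.All using (All)
open import Data.List.Membership.Propositional using (_∈_)
open import Data.Product using (Σ; ∃; _×_; _,_)
open import Data.Rational as Q using (ℚ)
open import Relation.Binary.PropositionalEquality using (_≡_)
open import Relation.Nullary using (¬_; yes; no)
open import Relation.Unary using (Pred; _⊆_)

record Field (c ℓ : Level) : Set (Level.suc (c ⊔ ℓ)) where
  field
    commutativeRing : CommutativeRing c ℓ
  open CommutativeRing commutativeRing public
  field
    1≉0     : ¬ (1# ≈ 0#)
    inverse : ∀ x → ¬ (x ≈ 0#) → Σ Carrier λ y → (x * y) ≈ 1#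

Infinite : ∀ {c ℓ} → Field c ℓ → Set (c ⊔ ℓ)
Infinite K = Σ (ℕ → Carrier) λ f → ∀ i j → f i ≈ f j → i ≡ j
  where open Field K

-- The lattice-polytope semiring 𝒜 (vertices in ℤⁿ_{≥0}, plus 0_𝒜).
-- A nonzero element is the convex hull of a nonempty finite list of
-- lattice points (v ∷ vs); equality is equality of convex hulls.

Pt : ℕ → Set
Pt n = Vec ℕ n

data 𝒜 (n : ℕ) : Set where
  0𝒜   : 𝒜 n
  conv : Pt n → List (Pt n) → 𝒜 n

toℚ : ∀ {n} → Pt n → Vec ℚ n
toℚ = V.map (λ k → Data.Integer.+ k Q./ 1)
  where import Data.Integer

lincomb : ∀ {n} → List ℚ → List (Pt n) → Vec ℚ n
lincomb (w ∷ ws) (p ∷ ps) = V.zipWith Q._+_ (V.map (w Q.*_) (toℚ p)) (lincomb ws ps)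
lincomb _        _        = V.replicate _ Q.0ℚ

InHull : ∀ {n} → Vec ℚ n → List (Pt n) → Set
InHull q ps = Σ (List ℚ) λ w →
  L.length w ≡ L.length ps × All (Q._≤_ Q.0ℚ) w × L.foldr Q._+_ Q.0ℚ w ≡ Q.1ℚ × lincomb w ps ≡ q

infix 4 _≈𝒜_
_≈𝒜_ : ∀ {n} → 𝒜 n → 𝒜 n → Set
0𝒜        ≈𝒜 0𝒜        = Data.Unit.⊤ where import Data.Unit
0𝒜        ≈𝒜 conv _ _  = Data.Empty.⊥ where import Data.Empty
conv _ _  ≈𝒜 0𝒜        = Data.Empty.⊥ where import Data.Empty
conv v vs ≈𝒜 conv w ws =
  All (λ p → InHull (toℚ p) (w ∷ ws)) (v ∷ vs) ×
  All (λ p → InHull (toℚ p) (v ∷ vs)) (w ∷ ws)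

infixl 6 _⊕_
_⊕_ : ∀ {n} → 𝒜 n → 𝒜 n → 𝒜 n
0𝒜        ⊕ Q         = Q
conv v vs ⊕ 0𝒜        = conv v vs
conv v vs ⊕ conv w ws = conv v (vs ++ w ∷ ws)

-- ⊙ : Minkowski sum (conv A + conv B = conv (A + B))
infixl 7 _⊙_
_⊙_ : ∀ {n} → 𝒜 n → 𝒜 n → 𝒜 n
0𝒜        ⊙ _         = 0𝒜
conv _ _  ⊙ 0𝒜        = 0𝒜
conv v vs ⊙ conv w ws with L.cartesianProductWith (V.zipWith ℕ._+_) (v ∷ vs) (w ∷ ws)
... | []     = 0𝒜   -- impossible: the product of nonempty lists is nonempty
... | p ∷ ps = conv p ps

-- Polynomials in n variables over a field K, as formal sums of terms
-- (coefficient, exponent vector); equality = equal coefficient functions.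

module Polynomials {c ℓ} (K : Field c ℓ) (n : ℕ) where
  open Field K

  Poly : Set c
  Poly = List (Carrier × Pt n)

  coeff : Poly → Pt n → Carrier
  coeff []            a = 0#
  coeff ((k , b) ∷ p) a with ≡-dec ℕ._≟_ a b
  ... | yes _ = k + coeff p a
  ... | no  _ = coeff p a

  infix 4 _≈P_
  _≈P_ : Poly → Poly → Set ℓ
  p ≈P q = ∀ a → coeff p a ≈ coeff q a

  0P : Poly
  0P = []

  infixl 6 _+P_
  _+P_ : Poly → Poly → Poly
  _+P_ = _++_

  infixl 7 _*P_
  _*P_ : Poly → Poly → Poly
  _*P_ = L.cartesianProductWith (λ { (k , a) (k' , b) → (k * k' , V.zipWith ℕ._+_ a b) })

  mono : Pt n → Poly
  mono a = (1# , a) ∷ []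

  Supp : Poly → Pt n → Set ℓ
  Supp p a = ¬ (coeff p a ≈ 0#)

  IsNew : Poly → 𝒜 n → Set ℓ
  IsNew p 0𝒜        = p ≈P 0P
  IsNew p (conv v vs) = Σ (Pt n) λ m → Σ (List (Pt n)) λ ms →
    All (Supp p) (m ∷ ms) ×
    (∀ a → Supp p a → InHull (toℚ a) (m ∷ ms)) ×
    conv v vs ≈𝒜 conv m ms

  sumGen : List (Poly × Pt n) → Poly
  sumGen []             = 0P
  sumGen ((q , a) ∷ ts) = q *P mono a +P sumGen ts

  GeneratesMono : ∀ {ℓI} → Pred Poly ℓI → Pred (Pt n) ℓI → Set (c ⊔ ℓ ⊔ ℓI)
  GeneratesMono I G = ∀ p → (I p → Σ (List (Poly × Pt n)) λ ts →
                                      All (λ t → G (Data.Product.proj₂ t)) ts × p ≈P sumGen ts)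
                          × ((Σ (List (Poly × Pt n)) λ ts →
                                      All (λ t → G (Data.Product.proj₂ t)) ts × p ≈P sumGen ts) → I p)

  IsMonomialIdeal : ∀ {ℓI} → Pred Poly ℓI → Set (c ⊔ ℓ ⊔ Level.suc ℓI)
  IsMonomialIdeal {ℓI} M = Σ (Pred (Pt n) ℓI) λ G → GeneratesMono M G

  IsMinimalMonomialGenSet : ∀ {ℓI} → Pred Poly ℓI → Pred (Pt n) ℓI → Set (c ⊔ ℓ ⊔ Level.suc ℓI)
  IsMinimalMonomialGenSet {ℓI} M G =
    GeneratesMono M G × (∀ (G' : Pred (Pt n) ℓI) → G' ⊆ G → GeneratesMono M G' → G ⊆ G')

  monos : ∀ {ℓI} → Pred (Pt n) ℓI → Pred Poly (c ⊔ ℓI)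
  monos G p = Σ (Pt n) λ a → G a × p ≡ mono a

  combo : List (𝒜 n × 𝒜 n) → 𝒜 n
  combo []             = 0𝒜
  combo ((a , P) ∷ ts) = a ⊙ P ⊕ combo ts

  InSpan : ∀ {ℓS} → Pred Poly ℓS → 𝒜 n → Set (c ⊔ ℓ ⊔ ℓS)
  InSpan S P = Σ (List (𝒜 n × 𝒜 n)) λ ts →
    All (λ t → Σ Poly λ p → S p × IsNew p (Data.Product.proj₂ t)) ts × P ≈𝒜 combo ts

  InNew : ∀ {ℓI} → Pred Poly ℓI → 𝒜 n → Set (c ⊔ ℓ ⊔ ℓI)
  InNew I P = Σ Poly λ p → I p × IsNew p P

  IsNewtonBasis : ∀ {ℓI ℓS} → Pred Poly ℓI → Pred Poly ℓS → Set (c ⊔ ℓ ⊔ ℓI ⊔ ℓS)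
  IsNewtonBasis I S = S ⊆ I × (∀ P → (InNew I P → InSpan S P) × (InSpan S P → InNew I P))

  IsMinimalNewtonBasis : ∀ {ℓI ℓS} → Pred Poly ℓI → Pred Poly ℓS → Set (c ⊔ ℓ ⊔ ℓI ⊔ Level.suc ℓS)
  IsMinimalNewtonBasis {ℓS = ℓS} I S =
    IsNewtonBasis I S × (∀ (T : Pred Poly ℓS) → T ⊆ S → IsNewtonBasis I T → S ⊆ T)

-- Every exponent in the support of a polynomial of M is a multiple y + g of a
-- generator g, so New(p) is the ⊕-combination of the points y ⊙ New(x^g).
-- Conversely, every vertex of a combination of the New(x^g) is such a
-- multiple, and the sum of the monomials at the distinct vertices lies in M
-- and has exactly these vertices as support. For minimality, the point a of
-- a generator x^a can only be spanned as y + g with x^g in the smaller basis,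
-- and minimality of G forces g = a: otherwise a could be removed from G.
module Submission where

open import Defs
open import Level using (Level; _⊔_)
open import Data.Nat as ℕ using (ℕ; zero; suc)
import Data.Nat.Properties as ℕP
open import Data.Integer as ℤ using (+_)
import Data.Integer.Properties as ℤP
import Data.Integer.GCD as ℤGCD
open import Data.Rational as Q using (ℚ)
import Data.Rational.Properties as QP
open import Data.Vec as V using (Vec; []; _∷_)
open import Data.Vec.Properties using (≡-dec)
import Data.Vec.Properties as VP
open import Data.List as L using (List; []; _∷_; deduplicate)
import Data.List.Properties as LP
open import Data.List.Relation.Unary.All as All using (All; []; _∷_)
open import Data.List.Relation.Unary.All.Properties using (++⁺; map⁺; replicate⁺; ¬Any⇒All¬; All¬⇒¬Any)
open import Data.List.Relation.Unary.Any using (Any; here; there; any?)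
open import Data.List.Membership.Propositional using (_∈_; _∉_)
open import Data.List.Membership.Propositional.Properties using (∈-++⁻; ∈-cartesianProductWith⁻; ∈-deduplicate⁺; ∈-deduplicate⁻)
open import Data.List.Membership.DecPropositional using (_∈?_)
open import Data.List.Relation.Unary.Unique.Propositional using (Unique)
open import Data.List.Relation.Unary.Unique.DecPropositional.Properties using (deduplicate-!)
open import Data.List.Relation.Unary.AllPairs using (_∷_)
open import Data.List.Relation.Binary.Pointwise as Pointwise using (Pointwise; []; _∷_)
open import Data.Product using (Σ; _×_; _,_; proj₁; proj₂)
open import Data.Sum using (inj₁; inj₂)
open import Data.Empty using (⊥-elim)
open import Data.Unit using (tt)
open import Function using (_∘_)
open import Relation.Binary.PropositionalEquality
open import Relation.Nullary using (Dec; yes; no)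
open import Relation.Nullary.Decidable using (toWitness)
open import Relation.Unary using (Pred; _⊆_)

_≟ₚ_ : ∀ {n} (a b : Pt n) → Dec (a ≡ b)
_≟ₚ_ = ≡-dec ℕ._≟_

infixl 6 _+ₚ_
_+ₚ_ : ∀ {n} → Pt n → Pt n → Pt n
_+ₚ_ = V.zipWith ℕ._+_

toℚ-injective : ∀ {n} (u v : Pt n) → toℚ u ≡ toℚ v → u ≡ v
toℚ-injective []       []       _  = refl
toℚ-injective (x ∷ xs) (y ∷ ys) eq = cong₂ _∷_ x≡y (toℚ-injective xs ys (VP.∷-injectiveʳ eq))
  where
  ∣↥[k/1]∣≡k : ∀ k → ℤ.∣ Q.↥ (+ k Q./ 1) ∣ ≡ k
  ∣↥[k/1]∣≡k k = cong ℤ.∣_∣ (begin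
    Q.↥ (+ k Q./ 1)                          ≡⟨ ℤP.*-identityʳ _ ⟨
    Q.↥ (+ k Q./ 1) ℤ.* ℤ.1ℤ                 ≡⟨ cong (Q.↥ (+ k Q./ 1) ℤ.*_) (ℤGCD.gcd-zeroʳ (+ k)) ⟨
    Q.↥ (+ k Q./ 1) ℤ.* ℤGCD.gcd (+ k) (+ 1) ≡⟨ QP.↥-/ (+ k) 1 ⟩
    + k                                      ∎)
    where open ≡-Reasoning
  x≡y : x ≡ y
  x≡y = trans (sym (∣↥[k/1]∣≡k x))
          (trans (cong (λ q → ℤ.∣ Q.↥ q ∣) (VP.∷-injectiveˡ eq)) (∣↥[k/1]∣≡k y))

map-0ℚ* : ∀ {n} (v : Vec ℚ n) → V.map (Q.0ℚ Q.*_) v ≡ V.replicate n Q.0ℚ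
map-0ℚ* v = trans (VP.map-cong QP.*-zeroˡ v) (VP.map-const v Q.0ℚ)

map-1ℚ* : ∀ {n} (v : Vec ℚ n) → V.map (Q.1ℚ Q.*_) v ≡ v
map-1ℚ* v = trans (VP.map-cong QP.*-identityˡ v) (VP.map-id v)

zipWith-+-map-* : ∀ {n} (a b : ℚ) (v : Vec ℚ n) →
  V.zipWith Q._+_ (V.map (a Q.*_) v) (V.map (b Q.*_) v) ≡ V.map ((a Q.+ b) Q.*_) v
zipWith-+-map-* a b []      = refl
zipWith-+-map-* a b (x ∷ v) = cong₂ _∷_ (sym (QP.*-distribʳ-+ x a b)) (zipWith-+-map-* a b v)

sumℚ : List ℚ → ℚ
sumℚ = L.foldr Q._+_ Q.0ℚ

lincomb-const : ∀ {n} (g : Pt n) (w : List ℚ) (ps : List (Pt n)) → All (_≡ g) ps →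
  L.length w ≡ L.length ps → lincomb w ps ≡ V.map (sumℚ w Q.*_) (toℚ g)
lincomb-const g []       []       []           _   = sym (map-0ℚ* (toℚ g))
lincomb-const g (w ∷ ws) (p ∷ ps) (refl ∷ ps≡g) len =
  trans (cong (V.zipWith Q._+_ (V.map (w Q.*_) (toℚ p)))
              (lincomb-const g ws ps ps≡g (ℕP.suc-injective len)))
        (zipWith-+-map-* w (sumℚ ws) (toℚ p))

InHull-const⇒≡ : ∀ {n} (g u : Pt n) (ps : List (Pt n)) → All (_≡ g) ps →
  InHull (toℚ u) ps → u ≡ g
InHull-const⇒≡ g u ps ps≡g (w , len , _ , Σw≡1 , lc) = toℚ-injective u g (begin
  toℚ u                             ≡⟨ lc ⟨
  lincomb w ps                      ≡⟨ lincomb-const g w ps ps≡g len ⟩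
  V.map (sumℚ w Q.*_) (toℚ g)       ≡⟨ cong (λ s → V.map (s Q.*_) (toℚ g)) Σw≡1 ⟩
  V.map (Q.1ℚ Q.*_) (toℚ g)         ≡⟨ map-1ℚ* (toℚ g) ⟩
  toℚ g                             ∎)
  where open ≡-Reasoning

∈⇒InHull : ∀ {n} (x : Pt n) (ps : List (Pt n)) → x ∈ ps → InHull (toℚ x) ps
∈⇒InHull x (.x ∷ ps) (here refl) =
  Q.1ℚ ∷ zeros , cong suc (LP.length-replicate (L.length ps)) ,
  toWitness {a? = Q.0ℚ Q.≤? Q.1ℚ} tt ∷ replicate⁺ (L.length ps) QP.≤-refl ,
  trans (cong (Q.1ℚ Q.+_) (sum-zeros (L.length ps))) (QP.+-identityʳ Q.1ℚ) ,
  trans (cong₂ (V.zipWith Q._+_) (map-1ℚ* (toℚ x)) (lincomb-zeros ps))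
        (VP.zipWith-identityʳ QP.+-identityʳ (toℚ x))
  where
  zeros = L.replicate (L.length ps) Q.0ℚ
  sum-zeros : ∀ k → sumℚ (L.replicate k Q.0ℚ) ≡ Q.0ℚ
  sum-zeros zero    = refl
  sum-zeros (suc k) = trans (cong (Q.0ℚ Q.+_) (sum-zeros k)) (QP.+-identityˡ Q.0ℚ)
  lincomb-zeros : ∀ {n} (qs : List (Pt n)) →
    lincomb (L.replicate (L.length qs) Q.0ℚ) qs ≡ V.replicate n Q.0ℚ
  lincomb-zeros []       = refl
  lincomb-zeros (q ∷ qs) =
    trans (cong₂ (V.zipWith Q._+_) (map-0ℚ* (toℚ q)) (lincomb-zeros qs))
          (VP.zipWith-identityˡ QP.+-identityˡ _)
∈⇒InHull x (y ∷ ps) (there x∈ps) with ∈⇒InHull x ps x∈ps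
... | w , len , w≥0 , Σw≡1 , lc =
  Q.0ℚ ∷ w , cong suc len , QP.≤-refl ∷ w≥0 , trans (QP.+-identityˡ _) Σw≡1 ,
  trans (cong₂ (V.zipWith Q._+_) (map-0ℚ* (toℚ y)) lc) (VP.zipWith-identityˡ QP.+-identityˡ _)

vertices : ∀ {n} → 𝒜 n → List (Pt n)
vertices 0𝒜         = []
vertices (conv v vs) = v ∷ vs

vertices-⊕ : ∀ {n} (A B : 𝒜 n) → vertices (A ⊕ B) ≡ vertices A L.++ vertices B
vertices-⊕ 0𝒜          B           = refl
vertices-⊕ (conv v vs) 0𝒜          = cong (v ∷_) (sym (LP.++-identityʳ vs))
vertices-⊕ (conv v vs) (conv w ws) = refl

vertices-⊙ : ∀ {n} (A B : 𝒜 n) {x} → x ∈ vertices (A ⊙ B) →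
  x ∈ L.cartesianProductWith _+ₚ_ (vertices A) (vertices B)
vertices-⊙ 0𝒜          B           ()
vertices-⊙ (conv _ _)  0𝒜          ()
vertices-⊙ (conv v vs) (conv w ws) x∈ with L.cartesianProductWith _+ₚ_ (v ∷ vs) (w ∷ ws)
... | []     = x∈
... | _ ∷ _  = x∈

≈𝒜-point⇒∈vertices : ∀ {n} (a : Pt n) C → conv a [] ≈𝒜 C → a ∈ vertices C
≈𝒜-point⇒∈vertices a (conv m ms) (_ , m∈hull ∷ _) =
  here (sym (InHull-const⇒≡ a m (a ∷ []) (refl ∷ []) m∈hull))

module _ {c ℓ} (K : Field c ℓ) (n : ℕ) where

  open Polynomials K n
  private module K = Field K
  open K using (Carrier; _≈_; 0#; 1#)

  infix 4 _≈ᵗ_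
  _≈ᵗ_ : Carrier × Pt n → Carrier × Pt n → Set ℓ
  (k , a) ≈ᵗ (k' , b) = k ≈ k' × a ≡ b

  coeff-cong : ∀ {p q} → Pointwise _≈ᵗ_ p q → p ≈P q
  coeff-cong []                                  x = K.refl
  coeff-cong {(_ , a) ∷ _} ((k≈k' , refl) ∷ p≈q) x with x ≟ₚ a
  ... | yes _ = K.+-cong k≈k' (coeff-cong p≈q x)
  ... | no  _ = coeff-cong p≈q x

  coeff-∉ : ∀ p x → All (λ t → proj₂ t ≢ x) p → coeff p x ≈ 0#
  coeff-∉ []            x []          = K.refl
  coeff-∉ ((k , b) ∷ p) x (b≢x ∷ p≢x) with x ≟ₚ b
  ... | yes x≡b = ⊥-elim (b≢x (sym x≡b))
  ... | no  _   = coeff-∉ p x p≢x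

  Supp⇒Any : ∀ p x → Supp p x → Any (λ t → proj₂ t ≡ x) p
  Supp⇒Any p x px≉0 with any? (λ t → proj₂ t ≟ₚ x) p
  ... | yes any = any
  ... | no ¬any = ⊥-elim (px≉0 (coeff-∉ p x (¬Any⇒All¬ p ¬any)))

  Supp-mono : ∀ a → Supp (mono a) a
  Supp-mono a with a ≟ₚ a
  ... | yes _   = λ 1+0≈0 → K.1≉0 (K.trans (K.sym (K.+-identityʳ 1#)) 1+0≈0)
  ... | no  a≢a = ⊥-elim (a≢a refl)

  Supp-mono⇒≡ : ∀ {a x} → Supp (mono a) x → x ≡ a
  Supp-mono⇒≡ {a} {x} s with x ≟ₚ a
  ... | yes x≡a = x≡a
  ... | no  _   = ⊥-elim (s K.refl)

  IsNew-mono : ∀ a → IsNew (mono a) (conv a [])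
  IsNew-mono a = a , [] , Supp-mono a ∷ [] ,
    (λ x s → subst (λ z → InHull (toℚ z) (a ∷ [])) (sym (Supp-mono⇒≡ s)) a∈hull) ,
    (a∈hull ∷ [] , a∈hull ∷ [])
    where a∈hull = ∈⇒InHull a (a ∷ []) (here refl)

  IsNew-mono⇒vertex≡ : ∀ a P {x} → IsNew (mono a) P → x ∈ vertices P → x ≡ a
  IsNew-mono⇒vertex≡ a 0𝒜          _                                  ()
  IsNew-mono⇒vertex≡ a (conv v vs) {x} (m , ms , supp , _ , P⊆ , _) x∈P =
    InHull-const⇒≡ a x (m ∷ ms) (All.map Supp-mono⇒≡ supp) (All.lookup P⊆ x∈P)

  monomialSum : List (Pt n) → Poly
  monomialSum = L.map (1# ,_)

  coeff-monomialSum-∉ : ∀ {as x} → x ∉ as → coeff (monomialSum as) x ≈ 0#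
  coeff-monomialSum-∉ {as} {x} x∉as =
    coeff-∉ (monomialSum as) x (map⁺ (All.map (λ x≢a a≡x → x≢a (sym a≡x)) (¬Any⇒All¬ as x∉as)))

  Supp-monomialSum⇒∈ : ∀ as x → Supp (monomialSum as) x → x ∈ as
  Supp-monomialSum⇒∈ as x s with _∈?_ _≟ₚ_ x as
  ... | yes x∈as = x∈as
  ... | no  x∉as = ⊥-elim (s (coeff-monomialSum-∉ x∉as))

  ∈⇒Supp-monomialSum : ∀ {as} → Unique as → ∀ x → x ∈ as → Supp (monomialSum as) x
  ∈⇒Supp-monomialSum {a ∷ as} (a∉as ∷ uniq) x x∈ with x ≟ₚ a
  ... | yes refl = λ 1+0≈0 → K.1≉0 (K.trans (K.sym 1+0≈1) 1+0≈0)
    where 1+0≈1 = K.trans (K.+-cong K.refl (coeff-monomialSum-∉ (All¬⇒¬Any a∉as))) (K.+-identityʳ 1#)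
  ... | no x≢a with x∈
  ...   | here x≡a  = ⊥-elim (x≢a x≡a)
  ...   | there x∈as = ∈⇒Supp-monomialSum uniq x x∈as

  Multiple : ∀ {ℓG} → Pred (Pt n) ℓG → Pred (Pt n) ℓG
  Multiple G x = Σ (Pt n) λ y → Σ (Pt n) λ g → G g × x ≡ y +ₚ g

  exponents-*P-mono : ∀ q a → All (λ t → Σ (Pt n) λ y → proj₂ t ≡ y +ₚ a) (q *P mono a)
  exponents-*P-mono []            a = []
  exponents-*P-mono ((k , b) ∷ q) a = (b , refl) ∷ exponents-*P-mono q a

  exponents-sumGen : ∀ {ℓG} {G : Pred (Pt n) ℓG} ts → All (λ t → G (proj₂ t)) ts →
    All (λ t → Multiple G (proj₂ t)) (sumGen ts)
  exponents-sumGen []            []         = []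
  exponents-sumGen ((q , g) ∷ ts) (Gg ∷ Gts) =
    ++⁺ (All.map (λ (y , e) → y , g , Gg , e) (exponents-*P-mono q g)) (exponents-sumGen ts Gts)

  sumGen-multiples : ∀ {ℓG} {G : Pred (Pt n) ℓG} {as} → All (Multiple G) as → List (Poly × Pt n)
  sumGen-multiples []                     = []
  sumGen-multiples ((y , g , _ , _) ∷ ds) = (mono y , g) ∷ sumGen-multiples ds

  sumGen-multiples≈monomialSum : ∀ {ℓG} {G : Pred (Pt n) ℓG} {as} (ds : All (Multiple G) as) →
    Pointwise _≈ᵗ_ (sumGen (sumGen-multiples ds)) (monomialSum as)
  sumGen-multiples≈monomialSum []                     = []
  sumGen-multiples≈monomialSum ((y , g , _ , e) ∷ ds) =
    (K.*-identityʳ 1# , sym e) ∷ sumGen-multiples≈monomialSum ds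

  sumGen-multiples-generators : ∀ {ℓG} {G : Pred (Pt n) ℓG} {as} (ds : All (Multiple G) as) →
    All (λ t → G (proj₂ t)) (sumGen-multiples ds)
  sumGen-multiples-generators []                   = []
  sumGen-multiples-generators ((_ , _ , Gg , _) ∷ ds) = Gg ∷ sumGen-multiples-generators ds

  vertices-InSpan : ∀ {ℓG ℓS} {G : Pred (Pt n) ℓG} (S : Pred Poly ℓS) → S ⊆ monos G → ∀ ts →
    All (λ t → Σ Poly λ p → S p × IsNew p (proj₂ t)) ts → ∀ x → x ∈ vertices (combo ts) →
    Σ (Pt n) λ y → Σ (Pt n) λ g → G g × S (mono g) × x ≡ y +ₚ g
  vertices-InSpan S S⊆ ((A , P) ∷ ts) ((p , Sp , p↦P) ∷ ts↦) x x∈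
    rewrite vertices-⊕ (A ⊙ P) (combo ts) with ∈-++⁻ (vertices (A ⊙ P)) x∈
  ... | inj₂ x∈ts = vertices-InSpan S S⊆ ts ts↦ x x∈ts
  ... | inj₁ x∈AP with ∈-cartesianProductWith⁻ _+ₚ_ (vertices A) (vertices P) (vertices-⊙ A P x∈AP)
                     | S⊆ Sp
  ...   | y , u , _ , u∈P , refl | g , Gg , refl =
    y , g , Gg , Sp , cong (y +ₚ_) (IsNew-mono⇒vertex≡ g P p↦P u∈P)

  module _ {ℓI} {M : Pred Poly ℓI} {G : Pred (Pt n) ℓI} (gen : GeneratesMono M G) where

    Supp⇒Multiple : ∀ p → M p → ∀ x → Supp p x → Multiple G x
    Supp⇒Multiple p Mp x s with proj₁ (gen p) Mp
    ... | ts , Gts , p≈ts with All.lookupAny (exponents-sumGen ts Gts)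
                                 (Supp⇒Any (sumGen ts) x (λ ts≈0 → s (K.trans (p≈ts x) ts≈0)))
    ...   | mult , t≡x = subst (Multiple G) t≡x mult

    mono∈M : ∀ {a} → G a → M (mono a)
    mono∈M {a} Ga = proj₂ (gen (mono a))
      ((mono (V.replicate n 0) , a) ∷ [] , Ga ∷ [] ,
        coeff-cong ((K.sym (K.*-identityʳ 1#) , sym (VP.zipWith-identityˡ ℕP.+-identityˡ a)) ∷ []))

    monomialSum∈M : ∀ {as} → All (Multiple G) as → M (monomialSum as)
    monomialSum∈M ds = proj₂ (gen _)
      (sumGen-multiples ds , sumGen-multiples-generators ds ,
        λ x → K.sym (coeff-cong (sumGen-multiples≈monomialSum ds) x))

    InNew-≈ : ∀ P C → P ≈𝒜 C → (∀ x → x ∈ vertices C → Multiple G x) → InNew M P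
    InNew-≈ 0𝒜 0𝒜 _ _ = 0P , proj₂ (gen 0P) ([] , [] , λ _ → K.refl) , λ _ → K.refl
    InNew-≈ (conv _ _) (conv v vs) P≈ mult =
      p , monomialSum∈M ds , v , vs , supp , supp⊆hull , P≈
      where
      as   = deduplicate _≟ₚ_ (v ∷ vs)
      ds   = All.tabulate λ a∈as → mult _ (∈-deduplicate⁻ _≟ₚ_ (v ∷ vs) a∈as)
      p    = monomialSum as
      supp = All.tabulate λ {x} x∈ →
        ∈⇒Supp-monomialSum (deduplicate-! _≟ₚ_ (v ∷ vs)) x (∈-deduplicate⁺ _≟ₚ_ x∈)
      supp⊆hull = λ x s →
        ∈⇒InHull x (v ∷ vs) (∈-deduplicate⁻ _≟ₚ_ (v ∷ vs) (Supp-monomialSum⇒∈ as x s))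

    InSpan⇒InNew : ∀ P → InSpan (monos G) P → InNew M P
    InSpan⇒InNew P (ts , ts↦ , P≈) = InNew-≈ P (combo ts) P≈ λ x x∈ →
      let (y , g , Gg , _ , e) = vertices-InSpan (monos G) (λ m → m) ts ts↦ x x∈ in y , g , Gg , e

    pointSummands : ∀ {as} → All (Multiple G) as → List (𝒜 n × 𝒜 n)
    pointSummands []                     = []
    pointSummands ((y , g , _ , _) ∷ ds) = (conv y [] , conv g []) ∷ pointSummands ds

    pointSummands-New : ∀ {as} (ds : All (Multiple G) as) →
      All (λ t → Σ Poly λ p → monos G p × IsNew p (proj₂ t)) (pointSummands ds)
    pointSummands-New []                      = []
    pointSummands-New ((_ , g , Gg , _) ∷ ds) = (mono g , (g , Gg , refl) , IsNew-mono g) ∷ pointSummands-New ds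

    combo-pointSummands : ∀ v vs (ds : All (Multiple G) (v ∷ vs)) → combo (pointSummands ds) ≡ conv v vs
    combo-pointSummands v []        ((_ , _ , _ , e) ∷ [])  = cong (λ z → conv z []) (sym e)
    combo-pointSummands v (w ∷ vs)  ((_ , _ , _ , e) ∷ ds) rewrite combo-pointSummands w vs ds =
      cong (λ z → conv z (w ∷ vs)) (sym e)

    InNew⇒InSpan : ∀ P → InNew M P → InSpan (monos G) P
    InNew⇒InSpan 0𝒜          _ = [] , [] , tt
    InNew⇒InSpan (conv v vs) (p , Mp , m , ms , supp , _ , P≈) =
      pointSummands ds , pointSummands-New ds ,
      subst (conv v vs ≈𝒜_) (sym (combo-pointSummands m ms ds)) P≈
      where ds = All.map (Supp⇒Multiple p Mp _) supp

    monos-isNewtonBasis : IsNewtonBasis M (monos G)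
    monos-isNewtonBasis = (λ { (a , Ga , refl) → mono∈M Ga }) , λ P → InNew⇒InSpan P , InSpan⇒InNew P

    GeneratesMono-remove : ∀ {a y g} → G g → g ≢ a → a ≡ y +ₚ g →
      GeneratesMono M (λ b → G b × b ≢ a)
    GeneratesMono-remove {a} {y} {g} Gg g≢a a≡y+g p =
      (λ Mp → let (ts , Gts , p≈ts) = proj₁ (gen p) Mp in
        replace ts , replace-generators ts Gts ,
        λ x → K.trans (p≈ts x) (K.sym (coeff-cong (sumGen-replace ts) x))) ,
      λ (ts , G′ts , p≈ts) → proj₂ (gen p) (ts , All.map proj₁ G′ts , p≈ts)
      where
      replace : List (Poly × Pt n) → List (Poly × Pt n)
      replace []             = []
      replace ((q , b) ∷ ts) with b ≟ₚ a
      ... | yes _ = (q *P mono y , g) ∷ replace ts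
      ... | no  _ = (q , b) ∷ replace ts
      replace-generators : ∀ ts → All (λ t → G (proj₂ t)) ts →
        All (λ t → G (proj₂ t) × proj₂ t ≢ a) (replace ts)
      replace-generators []             []         = []
      replace-generators ((q , b) ∷ ts) (Gb ∷ Gts) with b ≟ₚ a
      ... | yes _   = (Gg , g≢a) ∷ replace-generators ts Gts
      ... | no  b≢a = (Gb , b≢a) ∷ replace-generators ts Gts
      *P-mono-assoc : ∀ q → Pointwise _≈ᵗ_ ((q *P mono y) *P mono g) (q *P mono a)
      *P-mono-assoc []            = []
      *P-mono-assoc ((k , b) ∷ q) =
        (K.*-identityʳ _ , trans (VP.zipWith-assoc ℕP.+-assoc b y g) (cong (b +ₚ_) (sym a≡y+g)))
        ∷ *P-mono-assoc q
      sumGen-replace : ∀ ts → Pointwise _≈ᵗ_ (sumGen (replace ts)) (sumGen ts)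
      sumGen-replace []             = []
      sumGen-replace ((q , b) ∷ ts) with b ≟ₚ a
      ... | yes refl = Pointwise.++⁺ (*P-mono-assoc q) (sumGen-replace ts)
      ... | no  _    = Pointwise.++⁺ (Pointwise.refl (K.refl , refl)) (sumGen-replace ts)

  module _ {ℓI} {M : Pred Poly ℓI} {G : Pred (Pt n) ℓI} (minG : IsMinimalMonomialGenSet M G) where

    private gen = proj₁ minG

    generator-multiple⇒≡ : ∀ {a y g} → G a → G g → a ≡ y +ₚ g → g ≡ a
    generator-multiple⇒≡ {a} {y} {g} Ga Gg a≡y+g with g ≟ₚ a
    ... | yes g≡a = g≡a
    ... | no  g≢a = ⊥-elim (proj₂ (proj₂ minG _ proj₁ (GeneratesMono-remove gen Gg g≢a a≡y+g) Ga) refl)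

    monos-minimal : ∀ (T : Pred Poly (c ⊔ ℓI)) → T ⊆ monos G → IsNewtonBasis M T → monos G ⊆ T
    monos-minimal T T⊆ (_ , T-basis) (a , Ga , refl)
      with proj₁ (T-basis (conv a [])) (mono a , mono∈M gen Ga , IsNew-mono a)
    ... | ts , ts↦ , a≈ts
      with vertices-InSpan T T⊆ ts ts↦ a (≈𝒜-point⇒∈vertices a (combo ts) a≈ts)
    ...   | y , g , Gg , Tg , a≡y+g = subst (T ∘ mono) (generator-multiple⇒≡ Ga Gg a≡y+g) Tg

mainTheorem19 : ∀ {c ℓ ℓI : Level} (K : Field c ℓ) → Infinite K → (n : ℕ) →
    let open Polynomials K n in
    (M : Pred Poly ℓI) → IsMonomialIdeal M →
    (G : Pred (Pt n) ℓI) → IsMinimalMonomialGenSet M G →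
    IsMinimalNewtonBasis M (monos G)
mainTheorem19 K _ n M _ G minG = monos-isNewtonBasis K n (proj₁ minG) , monos-minimal K n minG
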